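{- Let $n\ge 4$. Let $L$ and $C$ be disjoint subsets of $[n]$ with $|C|\ge 4$, and let $C=C_1\sqcup\dots\sqcup C_s$ be a partition of $C$ into $s\ge 2$ pairwise disjoint sets with $|C_i|\ge 2$ for all $i$. Let $\mathcal{L}$ be the set $\{L,\ L\sqcup C_1,\dots, L\sqcup C_s,\ [n]\}$ ordered by inclusion, with the function $r$ given by $r(L)=0$, $r(L\sqcup C_i)=1$ for all $i$, and $r([n])=2$. Then $\mathcal{L}$ (with ranks $r$) is the lattice of cyclic flats $\mathcal{Z}(M)$ of a matroid $M$ of rank $2$ on $[n]$ which is not a Schubert matroid.
   Context: A cyclic flat of a matroid is a flat that is a union of circuits; $\mathcal{Z}(M)$ denotes the lattice of cyclic flats of $M$ ordered by inclusion, each equipped with its rank. A Schubert matroid is a matroid whose lattice of cyclic flats is a chain. -}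

module Defs where

open import Data.Nat using (ℕ; _≤_; _<_; _+_)
open import Data.Fin using (Fin)
open import Data.Fin.Subset using (Subset; _⊆_; _⊂_; _∪_; _∩_; _∈_; _∉_; ∣_∣; ⁅_⁆; ⊤; ⊥)
open import Data.Product using (Σ; _×_; ∃)
open import Data.Sum using (_⊎_)
open import Relation.Binary.PropositionalEquality using (_≡_)
open import Relation.Nullary using (¬_)

record Matroid (n : ℕ) : Set where
  field
    rank      : Subset n → ℕ
    rank-≤    : ∀ X → rank X ≤ ∣ X ∣
    rank-mono : ∀ {X Y} → X ⊆ Y → rank X ≤ rank Y
    rank-sub  : ∀ X Y → rank (X ∪ Y) + rank (X ∩ Y) ≤ rank X + rank Y
open Matroid public

module _ {n : ℕ} (M : Matroid n) where

  Independent : Subset n → Set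
  Independent X = rank M X ≡ ∣ X ∣

  Dependent : Subset n → Set
  Dependent X = ¬ Independent X

  IsCircuit : Subset n → Set
  IsCircuit X = Dependent X × (∀ Y → Y ⊂ X → Independent Y)

  IsFlat : Subset n → Set
  IsFlat X = ∀ e → e ∉ X → rank M X < rank M (X ∪ ⁅ e ⁆)

  IsCyclic : Subset n → Set
  IsCyclic X = ∀ e → e ∈ X → Σ (Subset n) λ D → IsCircuit D × D ⊆ X × e ∈ D

  IsCyclicFlat : Subset n → Set
  IsCyclicFlat X = IsFlat X × IsCyclic X

  rk : ℕ
  rk = rank M ⊤

  IsSchubert : Set
  IsSchubert = ∀ X Y → IsCyclicFlat X → IsCyclicFlat Y → X ⊆ Y ⊎ Y ⊆ X

Disjoint : ∀ {n} → Subset n → Subset n → Set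
Disjoint A B = A ∩ B ≡ ⊥

IsPartition : ∀ {n s} → Subset n → (Fin s → Subset n) → Set
IsPartition {n} {s} C P =
  (∀ i j → ¬ i ≡ j → Disjoint (P i) (P j)) ×
  (∀ (e : Fin n) → e ∈ C → ∃ λ i → e ∈ P i) ×
  (∀ i → P i ⊆ C) ×
  (∀ i → 2 ≤ ∣ P i ∣)

In𝓛 : ∀ {n s} → Subset n → (Fin s → Subset n) → Subset n → Set
In𝓛 L P X = X ≡ L ⊎ (∃ λ i → X ≡ L ∪ P i) ⊎ X ≡ ⊤

{-# OPTIONS --safe #-}
-- M is the rank-two matroid whose loops are L and whose parallel classes are the
-- blocks Cᵢ and the singletons outside L ∪ C: a set has rank 0 if it consists of
-- loops, rank 2 if it contains two non-parallel non-loops, and rank 1 otherwise.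
-- A flat of rank 1 that is cyclic must contain a parallel pair, hence is L ∪ Cᵢ;
-- the whole ground set is cyclic because every non-loop lies in a parallel pair
-- or in a triangle with elements of two different blocks.  Two distinct blocks
-- give incomparable cyclic flats, so 𝓩(M) is not a chain.
module Submission where

open import Defs
open import Data.Bool using (true; false)
open import Data.Nat using (ℕ; _≤_; _+_; z≤n; s≤s)
open import Data.Nat.Properties
  using (≤-refl; ≤-trans; ≤-reflexive; ≤-antisym; ≤-pred; <⇒≢; <⇒≱; n≮n; n≤1+n;
         +-mono-≤; +-monoʳ-≤; +-suc; +-comm; +-identityʳ; m≤m+n; m≤n+m; module ≤-Reasoning)
open import Data.Vec using ([]; _∷_)
open import Data.Fin using (Fin; zero; suc; _≟_)
open import Data.Fin.Properties using (any?)
open import Data.Fin.Subset using (Subset; ∣_∣; _∪_; _∩_; ⊤; ⊥; _∈_; _∉_; _⊆_; _⊂_; ⁅_⁆; Nonempty)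
open import Data.Fin.Subset.Properties
open import Data.Product using (Σ; _×_; _,_; ∃; ∃₂; proj₁; proj₂)
open import Data.Sum using (_⊎_; inj₁; inj₂; [_,_]′)
import Data.Sum as Sum
open import Function using (_∘_; id)
open import Function.Bundles using (_⇔_; mk⇔)
open import Level using (0ℓ)
open import Relation.Binary.Core using (Rel)
open import Relation.Binary.Structures using (IsDecEquivalence)
open import Relation.Binary.PropositionalEquality using (_≡_; _≢_; refl; sym; trans; subst; cong; cong₂)
open import Relation.Nullary using (¬_; Dec; yes; no)
open import Relation.Nullary.Negation using (contradiction)
open import Relation.Nullary.Decidable using (_×-dec_; _⊎-dec_; ¬?)

∣p∪q∣≤∣p∣+∣q∣ : ∀ {n} (p q : Subset n) → ∣ p ∪ q ∣ ≤ ∣ p ∣ + ∣ q ∣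
∣p∪q∣≤∣p∣+∣q∣ []          []          = z≤n
∣p∪q∣≤∣p∣+∣q∣ (true ∷ p)  (true ∷ q) = s≤s (≤-trans (∣p∪q∣≤∣p∣+∣q∣ p q) (+-monoʳ-≤ ∣ p ∣ (n≤1+n _)))
∣p∪q∣≤∣p∣+∣q∣ (true ∷ p)  (false ∷ q) = s≤s (∣p∪q∣≤∣p∣+∣q∣ p q)
∣p∪q∣≤∣p∣+∣q∣ (false ∷ p) (true ∷ q)  =
  ≤-trans (s≤s (∣p∪q∣≤∣p∣+∣q∣ p q)) (≤-reflexive (sym (+-suc ∣ p ∣ ∣ q ∣)))
∣p∪q∣≤∣p∣+∣q∣ (false ∷ p) (false ∷ q) = ∣p∪q∣≤∣p∣+∣q∣ p q

module _ {n : ℕ} where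

  x∈p⇒1≤∣p∣ : ∀ {p : Subset n} {x} → x ∈ p → 1 ≤ ∣ p ∣
  x∈p⇒1≤∣p∣ x∈p = ≤-trans (s≤s z≤n) (x∈p⇒∣p-x∣<∣p∣ x∈p)

  distinct⇒2≤∣p∣ : ∀ {p : Subset n} {x y} → x ∈ p → y ∈ p → x ≢ y → 2 ≤ ∣ p ∣
  distinct⇒2≤∣p∣ x∈p y∈p x≢y =
    ≤-trans (s≤s (x∈p⇒1≤∣p∣ (x∈p∧x≢y⇒x∈p-y y∈p (x≢y ∘ sym)))) (x∈p⇒∣p-x∣<∣p∣ x∈p)

  distinct⇒3≤∣p∣ : ∀ {p : Subset n} {x y z} → x ∈ p → y ∈ p → z ∈ p → x ≢ y → x ≢ z → y ≢ z → 3 ≤ ∣ p ∣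
  distinct⇒3≤∣p∣ x∈p y∈p z∈p x≢y x≢z y≢z =
    ≤-trans (s≤s (distinct⇒2≤∣p∣ (x∈p∧x≢y⇒x∈p-y y∈p (x≢y ∘ sym)) (x∈p∧x≢y⇒x∈p-y z∈p (x≢z ∘ sym)) y≢z))
            (x∈p⇒∣p-x∣<∣p∣ x∈p)

  ∣p∣≤1⇒x≡y : ∀ {p : Subset n} {x y} → ∣ p ∣ ≤ 1 → x ∈ p → y ∈ p → x ≡ y
  ∣p∣≤1⇒x≡y {x = x} {y} ∣p∣≤1 x∈p y∈p with x ≟ y
  ... | yes x≡y = x≡y
  ... | no x≢y  = contradiction (≤-trans (distinct⇒2≤∣p∣ x∈p y∈p x≢y) ∣p∣≤1) (n≮n 1)

  1≤∣p∣⇒Nonempty : ∀ {p : Subset n} → 1 ≤ ∣ p ∣ → Nonempty p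
  1≤∣p∣⇒Nonempty {p} 1≤∣p∣ with nonempty? p
  ... | yes nonempty = nonempty
  ... | no empty     = contradiction (≤-trans 1≤∣p∣ (≤-reflexive ∣p∣≡0)) (n≮n 0)
    where
    ∣p∣≡0 : ∣ p ∣ ≡ 0
    ∣p∣≡0 = trans (cong ∣_∣ (Empty-unique empty)) (∣⊥∣≡0 n)

  ⁅x⁆⊆p : ∀ {p : Subset n} {x} → x ∈ p → ⁅ x ⁆ ⊆ p
  ⁅x⁆⊆p {p} {x} x∈p y∈⁅x⁆ = subst (_∈ p) (sym (x∈⁅y⁆⇒x≡y x y∈⁅x⁆)) x∈p

  ⊆⁅x⁆⇒∣p∣≤1 : ∀ {p : Subset n} {x} → p ⊆ ⁅ x ⁆ → ∣ p ∣ ≤ 1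
  ⊆⁅x⁆⇒∣p∣≤1 {x = x} p⊆⁅x⁆ = ≤-trans (p⊆q⇒∣p∣≤∣q∣ p⊆⁅x⁆) (≤-reflexive (∣⁅x⁆∣≡1 x))

  ⊂⁅x⁆⇒∉ : ∀ {p : Subset n} {x y} → p ⊂ ⁅ x ⁆ → y ∉ p
  ⊂⁅x⁆⇒∉ {p} {x} (p⊆⁅x⁆ , z , z∈⁅x⁆ , z∉p) y∈p =
    z∉p (subst (_∈ p) (trans (x∈⁅y⁆⇒x≡y x (p⊆⁅x⁆ y∈p)) (sym (x∈⁅y⁆⇒x≡y x z∈⁅x⁆))) y∈p)

  ⊆⁅x⁆⊎other : ∀ (p : Subset n) x → p ⊆ ⁅ x ⁆ ⊎ ∃ λ y → y ∈ p × x ≢ y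
  ⊆⁅x⁆⊎other p x with any? (λ y → (y ∈? p) ×-dec ¬? (x ≟ y))
  ... | yes other = inj₂ other
  ... | no none   = inj₁ p⊆⁅x⁆
    where
    p⊆⁅x⁆ : p ⊆ ⁅ x ⁆
    p⊆⁅x⁆ {y} y∈p with x ≟ y
    ... | yes refl = x∈⁅x⁆ x
    ... | no x≢y   = contradiction (y , y∈p , x≢y) none

  other-element : ∀ {p : Subset n} {x} → 2 ≤ ∣ p ∣ → ∃ λ y → y ∈ p × x ≢ y
  other-element {p} {x} 2≤∣p∣ with ⊆⁅x⁆⊎other p x
  ... | inj₁ p⊆⁅x⁆ = contradiction (≤-trans 2≤∣p∣ (⊆⁅x⁆⇒∣p∣≤1 p⊆⁅x⁆)) (n≮n 1)
  ... | inj₂ other = other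

  ∈⁅x⁆∪⁅y⁆ : ∀ {x y z : Fin n} → z ∈ ⁅ x ⁆ ∪ ⁅ y ⁆ → z ≡ x ⊎ z ≡ y
  ∈⁅x⁆∪⁅y⁆ {x} {y} z∈ = Sum.map (x∈⁅y⁆⇒x≡y x) (x∈⁅y⁆⇒x≡y y) (x∈p∪q⁻ ⁅ x ⁆ ⁅ y ⁆ z∈)

  ∈⁅x⁆∪⁅y⁆∪⁅z⁆ : ∀ {x y z w : Fin n} → w ∈ ⁅ x ⁆ ∪ ⁅ y ⁆ ∪ ⁅ z ⁆ → w ≡ x ⊎ w ≡ y ⊎ w ≡ z
  ∈⁅x⁆∪⁅y⁆∪⁅z⁆ {x} {y} {z} w∈ = Sum.map (x∈⁅y⁆⇒x≡y x) ∈⁅x⁆∪⁅y⁆ (x∈p∪q⁻ ⁅ x ⁆ (⁅ y ⁆ ∪ ⁅ z ⁆) w∈)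

  ⁅x⁆∪⁅y⁆⊆p : ∀ {p : Subset n} {x y} → x ∈ p → y ∈ p → ⁅ x ⁆ ∪ ⁅ y ⁆ ⊆ p
  ⁅x⁆∪⁅y⁆⊆p x∈p y∈p z∈ with ∈⁅x⁆∪⁅y⁆ z∈
  ... | inj₁ refl = x∈p
  ... | inj₂ refl = y∈p

  ∣⁅x⁆∪⁅y⁆∣≤2 : ∀ (x y : Fin n) → ∣ ⁅ x ⁆ ∪ ⁅ y ⁆ ∣ ≤ 2
  ∣⁅x⁆∪⁅y⁆∣≤2 x y =
    ≤-trans (∣p∪q∣≤∣p∣+∣q∣ ⁅ x ⁆ ⁅ y ⁆) (≤-reflexive (cong₂ _+_ (∣⁅x⁆∣≡1 x) (∣⁅x⁆∣≡1 y)))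

  ∣⁅x⁆∪⁅y⁆∪⁅z⁆∣≤3 : ∀ (x y z : Fin n) → ∣ ⁅ x ⁆ ∪ ⁅ y ⁆ ∪ ⁅ z ⁆ ∣ ≤ 3
  ∣⁅x⁆∪⁅y⁆∪⁅z⁆∣≤3 x y z =
    ≤-trans (∣p∪q∣≤∣p∣+∣q∣ ⁅ x ⁆ (⁅ y ⁆ ∪ ⁅ z ⁆)) (+-mono-≤ (≤-reflexive (∣⁅x⁆∣≡1 x)) (∣⁅x⁆∪⁅y⁆∣≤2 y z))

flat-closed : ∀ {n} (M : Matroid n) {X e} → IsFlat M X → rank M (X ∪ ⁅ e ⁆) ≤ rank M X → e ∈ X
flat-closed M {X} {e} flat rank≤ with e ∈? X
... | yes e∈X = e∈X
... | no e∉X  = contradiction rank≤ (<⇒≱ (flat e e∉X))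

module RankTwo {n : ℕ} (L : Subset n) {_∥_ : Rel (Fin n) 0ℓ}
               (∥-isDecEquivalence : IsDecEquivalence _∥_) where

  open IsDecEquivalence ∥-isDecEquivalence
    using () renaming (refl to ∥-refl; sym to ∥-sym; trans to ∥-trans; _≟_ to _∥?_)

  NonLoop : Subset n → Fin n → Set
  NonLoop X e = e ∈ X × e ∉ L

  HasNonLoop : Subset n → Set
  HasNonLoop X = ∃ (NonLoop X)

  HasNonParallelPair : Subset n → Set
  HasNonParallelPair X = ∃₂ λ e f → NonLoop X e × NonLoop X f × ¬ e ∥ f

  _⊑_ : Subset n → Subset n → Set
  X ⊑ Y = ∀ {e} → NonLoop X e → NonLoop Y e

  nonLoop? : ∀ X e → Dec (NonLoop X e)
  nonLoop? X e = (e ∈? X) ×-dec ¬? (e ∈? L)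

  hasNonLoop? : ∀ X → Dec (HasNonLoop X)
  hasNonLoop? X = any? (nonLoop? X)

  hasNonParallelPair? : ∀ X → Dec (HasNonParallelPair X)
  hasNonParallelPair? X =
    any? λ e → any? λ f → nonLoop? X e ×-dec nonLoop? X f ×-dec ¬? (e ∥? f)

  rank₂ : Subset n → ℕ
  rank₂ X with hasNonParallelPair? X | hasNonLoop? X
  ... | yes _ | _     = 2
  ... | no _  | yes _ = 1
  ... | no _  | no _  = 0

  rank₂≤2 : ∀ X → rank₂ X ≤ 2
  rank₂≤2 X with hasNonParallelPair? X | hasNonLoop? X
  ... | yes _ | _     = ≤-refl
  ... | no _  | yes _ = s≤s z≤n
  ... | no _  | no _  = z≤n

  pair⇒rank₂≡2 : ∀ {X} → HasNonParallelPair X → rank₂ X ≡ 2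
  pair⇒rank₂≡2 {X} pair with hasNonParallelPair? X
  ... | yes _    = refl
  ... | no ¬pair = contradiction pair ¬pair

  ¬pair⇒rank₂≤1 : ∀ {X} → ¬ HasNonParallelPair X → rank₂ X ≤ 1
  ¬pair⇒rank₂≤1 {X} ¬pair with hasNonParallelPair? X | hasNonLoop? X
  ... | yes pair | _     = contradiction pair ¬pair
  ... | no _     | yes _ = ≤-refl
  ... | no _     | no _  = z≤n

  nonLoop⇒1≤rank₂ : ∀ {X} → HasNonLoop X → 1 ≤ rank₂ X
  nonLoop⇒1≤rank₂ {X} nonLoop with hasNonParallelPair? X | hasNonLoop? X
  ... | yes _ | _       = s≤s z≤n
  ... | no _  | yes _   = ≤-refl
  ... | no _  | no ¬any = contradiction nonLoop ¬any

  ¬nonLoop⇒rank₂≡0 : ∀ {X} → ¬ HasNonLoop X → rank₂ X ≡ 0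
  ¬nonLoop⇒rank₂≡0 {X} ¬any with hasNonParallelPair? X | hasNonLoop? X
  ... | yes (e , _ , nonLoop , _) | _ = contradiction (e , nonLoop) ¬any
  ... | no _ | yes nonLoop = contradiction nonLoop ¬any
  ... | no _ | no _        = refl

  ∦⇒≢ : ∀ {e f} → ¬ e ∥ f → e ≢ f
  ∦⇒≢ e∦f refl = e∦f ∥-refl

  pairwiseParallel : ∀ {X e f} → ¬ HasNonParallelPair X → NonLoop X e → NonLoop X f → e ∥ f
  pairwiseParallel {e = e} {f} ¬pair ne nf with e ∥? f
  ... | yes e∥f = e∥f
  ... | no e∦f  = contradiction (e , f , ne , nf , e∦f) ¬pair

  parallelTo⇒¬pair : ∀ {X c} → (∀ {y} → NonLoop X y → c ∥ y) → ¬ HasNonParallelPair X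
  parallelTo⇒¬pair c∥ (_ , _ , ne , nf , e∦f) = e∦f (∥-trans (∥-sym (c∥ ne)) (c∥ nf))

  ⊆⇒⊑ : ∀ {X Y} → X ⊆ Y → X ⊑ Y
  ⊆⇒⊑ X⊆Y (e∈X , e∉L) = X⊆Y e∈X , e∉L

  nonLoop-mono : ∀ {X Y} → X ⊑ Y → HasNonLoop X → HasNonLoop Y
  nonLoop-mono X⊑Y (e , ne) = e , X⊑Y ne

  pair-mono : ∀ {X Y} → X ⊑ Y → HasNonParallelPair X → HasNonParallelPair Y
  pair-mono X⊑Y (e , f , ne , nf , e∦f) = e , f , X⊑Y ne , X⊑Y nf , e∦f

  rank₂-mono : ∀ {X Y} → X ⊑ Y → rank₂ X ≤ rank₂ Y
  rank₂-mono {X} X⊑Y with hasNonParallelPair? X | hasNonLoop? X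
  ... | yes pair | _       = ≤-reflexive (sym (pair⇒rank₂≡2 (pair-mono X⊑Y pair)))
  ... | no _     | yes any = nonLoop⇒1≤rank₂ (nonLoop-mono X⊑Y any)
  ... | no _     | no _    = z≤n

  rank₂≤∣X∣ : ∀ X → rank₂ X ≤ ∣ X ∣
  rank₂≤∣X∣ X with hasNonParallelPair? X | hasNonLoop? X
  ... | yes (_ , _ , (e∈X , _) , (f∈X , _) , e∦f) | _ = distinct⇒2≤∣p∣ e∈X f∈X (∦⇒≢ e∦f)
  ... | no _ | yes (_ , e∈X , _) = x∈p⇒1≤∣p∣ e∈X
  ... | no _ | no _              = z≤n

  nonLoop-∪⁻ : ∀ {X Y e} → NonLoop (X ∪ Y) e → NonLoop X e ⊎ NonLoop Y e
  nonLoop-∪⁻ {X} {Y} (e∈ , e∉L) = Sum.map (_, e∉L) (_, e∉L) (x∈p∪q⁻ X Y e∈)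

  ¬nonLoop-∪ : ∀ {X Y} → ¬ HasNonLoop X → (X ∪ Y) ⊑ Y
  ¬nonLoop-∪ ¬anyX ne = [ (λ neX → contradiction (_ , neX) ¬anyX) , id ]′ (nonLoop-∪⁻ ne)

  rank₂-∪ : ∀ X Y → rank₂ (X ∪ Y) ≤ rank₂ X + rank₂ Y
  rank₂-∪ X Y = cases (hasNonLoop? X) (hasNonLoop? Y)
    where
    cases : Dec (HasNonLoop X) → Dec (HasNonLoop Y) → rank₂ (X ∪ Y) ≤ rank₂ X + rank₂ Y
    cases (no ¬anyX) _ = ≤-trans (rank₂-mono (¬nonLoop-∪ ¬anyX)) (m≤n+m _ _)
    cases _ (no ¬anyY) = ≤-trans (rank₂-mono (¬nonLoop-∪ ¬anyY ∘ ⊆⇒⊑ (⊆-reflexive (∪-comm X Y))))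
                                 (m≤m+n _ _)
    cases (yes anyX) (yes anyY) =
      ≤-trans (rank₂≤2 _) (+-mono-≤ (nonLoop⇒1≤rank₂ anyX) (nonLoop⇒1≤rank₂ anyY))

  ¬pair-∪ : ∀ {X Y} → ¬ HasNonParallelPair X → ¬ HasNonParallelPair Y →
            HasNonLoop (X ∩ Y) → ¬ HasNonParallelPair (X ∪ Y)
  ¬pair-∪ {X} {Y} ¬pairX ¬pairY (g , g∈X∩Y , g∉L) = parallelTo⇒¬pair g∥
    where
    g∥ : ∀ {y} → NonLoop (X ∪ Y) y → g ∥ y
    g∥ ny with nonLoop-∪⁻ ny
    ... | inj₁ nyX = pairwiseParallel ¬pairX (p∩q⊆p X Y g∈X∩Y , g∉L) nyX
    ... | inj₂ nyY = pairwiseParallel ¬pairY (p∩q⊆q X Y g∈X∩Y , g∉L) nyY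

  -- If X ∩ Y consists of loops this is subadditivity; otherwise ranks are at most 2, so
  -- only rank₂ X = rank₂ Y = 1 needs an argument, and there ¬pair-∪ gives rank₂ (X ∪ Y) ≤ 1.
  rank₂-submodular : ∀ X Y → rank₂ (X ∪ Y) + rank₂ (X ∩ Y) ≤ rank₂ X + rank₂ Y
  rank₂-submodular X Y = cases (hasNonLoop? (X ∩ Y)) (hasNonParallelPair? X) (hasNonParallelPair? Y)
    where
    open ≤-Reasoning
    cases : Dec (HasNonLoop (X ∩ Y)) → Dec (HasNonParallelPair X) → Dec (HasNonParallelPair Y) →
            rank₂ (X ∪ Y) + rank₂ (X ∩ Y) ≤ rank₂ X + rank₂ Y
    cases (no ¬any∩) _ _ = begin
      rank₂ (X ∪ Y) + rank₂ (X ∩ Y) ≡⟨ cong (rank₂ (X ∪ Y) +_) (¬nonLoop⇒rank₂≡0 ¬any∩) ⟩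
      rank₂ (X ∪ Y) + 0             ≡⟨ +-identityʳ _ ⟩
      rank₂ (X ∪ Y)                 ≤⟨ rank₂-∪ X Y ⟩
      rank₂ X + rank₂ Y             ∎
    cases (yes _) (yes pairX) _ = begin
      rank₂ (X ∪ Y) + rank₂ (X ∩ Y) ≤⟨ +-mono-≤ (rank₂≤2 _) (rank₂-mono (⊆⇒⊑ (p∩q⊆q X Y))) ⟩
      2 + rank₂ Y                   ≡⟨ cong (_+ rank₂ Y) (sym (pair⇒rank₂≡2 pairX)) ⟩
      rank₂ X + rank₂ Y             ∎
    cases (yes _) (no _) (yes pairY) = begin
      rank₂ (X ∪ Y) + rank₂ (X ∩ Y) ≤⟨ +-mono-≤ (rank₂≤2 _) (rank₂-mono (⊆⇒⊑ (p∩q⊆p X Y))) ⟩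
      2 + rank₂ X                   ≡⟨ +-comm 2 _ ⟩
      rank₂ X + 2                   ≡⟨ cong (rank₂ X +_) (sym (pair⇒rank₂≡2 pairY)) ⟩
      rank₂ X + rank₂ Y             ∎
    cases (yes any∩) (no ¬pairX) (no ¬pairY) = begin
      rank₂ (X ∪ Y) + rank₂ (X ∩ Y) ≤⟨ +-mono-≤ (¬pair⇒rank₂≤1 (¬pair-∪ ¬pairX ¬pairY any∩))
                                                (¬pair⇒rank₂≤1 (¬pairX ∘ pair-mono (⊆⇒⊑ (p∩q⊆p X Y)))) ⟩
      1 + 1                         ≤⟨ +-mono-≤ (nonLoop⇒1≤rank₂ (nonLoop-mono (⊆⇒⊑ (p∩q⊆p X Y)) any∩))
                                                (nonLoop⇒1≤rank₂ (nonLoop-mono (⊆⇒⊑ (p∩q⊆q X Y)) any∩)) ⟩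
      rank₂ X + rank₂ Y             ∎

  matroid : Matroid n
  matroid = record
    { rank      = rank₂
    ; rank-≤    = rank₂≤∣X∣
    ; rank-mono = rank₂-mono ∘ ⊆⇒⊑
    ; rank-sub  = rank₂-submodular
    }

  Simple : Subset n → Set
  Simple Y = (∀ {e} → e ∈ Y → e ∉ L) × (∀ {e f} → e ∈ Y → f ∈ Y → e ∥ f → e ≡ f)

  simple⇒independent : ∀ {Y} → Simple Y → ∣ Y ∣ ≤ 2 → Independent matroid Y
  simple⇒independent {Y} (loopless , parallel⇒≡) ∣Y∣≤2 =
    ≤-antisym (rank₂≤∣X∣ Y) (cases (hasNonParallelPair? Y) (nonempty? Y))
    where
    cases : Dec (HasNonParallelPair Y) → Dec (Nonempty Y) → ∣ Y ∣ ≤ rank₂ Y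
    cases (yes pair) _ = ≤-trans ∣Y∣≤2 (≤-reflexive (sym (pair⇒rank₂≡2 pair)))
    cases (no ¬pair) (yes (e , e∈Y)) =
      ≤-trans (⊆⁅x⁆⇒∣p∣≤1 Y⊆⁅e⁆) (nonLoop⇒1≤rank₂ (e , e∈Y , loopless e∈Y))
      where
      Y⊆⁅e⁆ : Y ⊆ ⁅ e ⁆
      Y⊆⁅e⁆ f∈Y = subst (_∈ ⁅ e ⁆) (parallel⇒≡ e∈Y f∈Y e∥f) (x∈⁅x⁆ e)
        where e∥f = pairwiseParallel ¬pair (e∈Y , loopless e∈Y) (f∈Y , loopless f∈Y)
    cases (no _) (no empty) =
      ≤-trans (p⊆q⇒∣p∣≤∣q∣ {q = ⊥} (λ e∈Y → contradiction (_ , e∈Y) empty))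
              (≤-trans (≤-reflexive (∣⊥∣≡0 n)) z≤n)

  ∣Y∣≤1⇒simple : ∀ {Y} → ∣ Y ∣ ≤ 1 → (∀ {e} → e ∈ Y → e ∉ L) → Simple Y
  ∣Y∣≤1⇒simple ∣Y∣≤1 loopless = loopless , λ e∈Y f∈Y _ → ∣p∣≤1⇒x≡y ∣Y∣≤1 e∈Y f∈Y

  circuit-criterion : ∀ {D} → Dependent matroid D → ∣ D ∣ ≤ 3 → (∀ {Y} → Y ⊂ D → Simple Y) →
                      IsCircuit matroid D
  circuit-criterion dependent ∣D∣≤3 simple =
    dependent , λ Y Y⊂D → simple⇒independent (simple Y⊂D) (≤-pred (≤-trans (p⊂q⇒∣p∣<∣q∣ Y⊂D) ∣D∣≤3))

  loop-circuit : ∀ {l} → l ∈ L → IsCircuit matroid ⁅ l ⁆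
  loop-circuit {l} l∈L =
    circuit-criterion dependent (≤-trans (≤-reflexive (∣⁅x⁆∣≡1 l)) (s≤s z≤n))
      (λ Y⊂⁅l⁆ → (λ e∈Y → contradiction e∈Y (⊂⁅x⁆⇒∉ Y⊂⁅l⁆)) ,
                 (λ e∈Y _ _ → contradiction e∈Y (⊂⁅x⁆⇒∉ Y⊂⁅l⁆)))
    where
    dependent : Dependent matroid ⁅ l ⁆
    dependent rank≡1 =
      contradiction (trans (sym (¬nonLoop⇒rank₂≡0 onlyLoop)) (trans rank≡1 (∣⁅x⁆∣≡1 l))) λ ()
      where
      onlyLoop : ¬ HasNonLoop ⁅ l ⁆
      onlyLoop (_ , e∈⁅l⁆ , e∉L) = e∉L (⁅x⁆⊆p l∈L e∈⁅l⁆)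

  parallel-circuit : ∀ {e f} → e ∉ L → f ∉ L → e ≢ f → e ∥ f → IsCircuit matroid (⁅ e ⁆ ∪ ⁅ f ⁆)
  parallel-circuit {e} {f} e∉L f∉L e≢f e∥f =
    circuit-criterion dependent (≤-trans (∣⁅x⁆∪⁅y⁆∣≤2 e f) (n≤1+n 2))
      (λ Y⊂D → ∣Y∣≤1⇒simple (≤-pred (≤-trans (p⊂q⇒∣p∣<∣q∣ Y⊂D) (∣⁅x⁆∪⁅y⁆∣≤2 e f)))
                             (loopless ∘ p⊂q⇒p⊆q Y⊂D))
    where
    loopless : ∀ {x} → x ∈ ⁅ e ⁆ ∪ ⁅ f ⁆ → x ∉ L
    loopless x∈ with ∈⁅x⁆∪⁅y⁆ x∈
    ... | inj₁ refl = e∉L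
    ... | inj₂ refl = f∉L
    e∥ : ∀ {y} → NonLoop (⁅ e ⁆ ∪ ⁅ f ⁆) y → e ∥ y
    e∥ (y∈ , _) with ∈⁅x⁆∪⁅y⁆ y∈
    ... | inj₁ refl = ∥-refl
    ... | inj₂ refl = e∥f
    dependent : Dependent matroid (⁅ e ⁆ ∪ ⁅ f ⁆)
    dependent = <⇒≢ (≤-trans (s≤s (¬pair⇒rank₂≤1 (parallelTo⇒¬pair e∥)))
                             (distinct⇒2≤∣p∣ (x∈p∪q⁺ (inj₁ (x∈⁅x⁆ e))) (x∈p∪q⁺ (inj₂ (x∈⁅x⁆ f))) e≢f))

  triangle-circuit : ∀ {a b c} → a ∉ L → b ∉ L → c ∉ L → ¬ a ∥ b → ¬ a ∥ c → ¬ b ∥ c →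
                     IsCircuit matroid (⁅ a ⁆ ∪ ⁅ b ⁆ ∪ ⁅ c ⁆)
  triangle-circuit {a} {b} {c} a∉L b∉L c∉L a∦b a∦c b∦c =
    circuit-criterion dependent (∣⁅x⁆∪⁅y⁆∪⁅z⁆∣≤3 a b c)
      (λ Y⊂D → loopless ∘ p⊂q⇒p⊆q Y⊂D , λ e∈Y f∈Y → parallel⇒≡ (p⊂q⇒p⊆q Y⊂D e∈Y) (p⊂q⇒p⊆q Y⊂D f∈Y))
    where
    D = ⁅ a ⁆ ∪ ⁅ b ⁆ ∪ ⁅ c ⁆
    loopless : ∀ {x} → x ∈ D → x ∉ L
    loopless x∈ with ∈⁅x⁆∪⁅y⁆∪⁅z⁆ x∈
    ... | inj₁ refl        = a∉L
    ... | inj₂ (inj₁ refl) = b∉L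
    ... | inj₂ (inj₂ refl) = c∉L
    parallel⇒≡ : ∀ {e f} → e ∈ D → f ∈ D → e ∥ f → e ≡ f
    parallel⇒≡ e∈ f∈ e∥f with ∈⁅x⁆∪⁅y⁆∪⁅z⁆ e∈ | ∈⁅x⁆∪⁅y⁆∪⁅z⁆ f∈
    ... | inj₁ refl        | inj₁ refl        = refl
    ... | inj₁ refl        | inj₂ (inj₁ refl) = contradiction e∥f a∦b
    ... | inj₁ refl        | inj₂ (inj₂ refl) = contradiction e∥f a∦c
    ... | inj₂ (inj₁ refl) | inj₁ refl        = contradiction (∥-sym e∥f) a∦b
    ... | inj₂ (inj₁ refl) | inj₂ (inj₁ refl) = refl
    ... | inj₂ (inj₁ refl) | inj₂ (inj₂ refl) = contradiction e∥f b∦c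
    ... | inj₂ (inj₂ refl) | inj₁ refl        = contradiction (∥-sym e∥f) a∦c
    ... | inj₂ (inj₂ refl) | inj₂ (inj₁ refl) = contradiction (∥-sym e∥f) b∦c
    ... | inj₂ (inj₂ refl) | inj₂ (inj₂ refl) = refl
    dependent : Dependent matroid D
    dependent = <⇒≢ (≤-trans (s≤s (rank₂≤2 D))
                             (distinct⇒3≤∣p∣ (x∈p∪q⁺ (inj₁ (x∈⁅x⁆ a)))
                                             (x∈p∪q⁺ (inj₂ (x∈p∪q⁺ (inj₁ (x∈⁅x⁆ b)))))
                                             (x∈p∪q⁺ (inj₂ (x∈p∪q⁺ (inj₂ (x∈⁅x⁆ c)))))
                                             (∦⇒≢ a∦b) (∦⇒≢ a∦c) (∦⇒≢ b∦c)))

  circuit-loopless : ∀ {D e} → IsCircuit matroid D → NonLoop D e → ∀ {l} → l ∈ D → l ∉ L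
  circuit-loopless {e = e} (_ , minimal) (e∈D , e∉L) {l} l∈D l∈L =
    proj₁ (loop-circuit l∈L) (minimal ⁅ l ⁆ (⁅x⁆⊆p l∈D , e , e∈D , λ e∈⁅l⁆ → e∉L (⁅x⁆⊆p l∈L e∈⁅l⁆)))

  circuit-partner : ∀ {D e} → IsCircuit matroid D → NonLoop D e → ∃ λ f → NonLoop D f × e ≢ f
  circuit-partner {D} {e} circuit ne with ⊆⁅x⁆⊎other D e
  ... | inj₂ (f , f∈D , e≢f) = f , (f∈D , circuit-loopless circuit ne f∈D) , e≢f
  ... | inj₁ D⊆⁅e⁆ = contradiction (simple⇒independent simple (≤-trans ∣D∣≤1 (n≤1+n 1))) (proj₁ circuit)
    where
    ∣D∣≤1 = ⊆⁅x⁆⇒∣p∣≤1 D⊆⁅e⁆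
    simple = ∣Y∣≤1⇒simple ∣D∣≤1 (circuit-loopless circuit ne)

  CircuitThrough : Subset n → Fin n → Set
  CircuitThrough X e = Σ (Subset n) λ D → IsCircuit matroid D × D ⊆ X × e ∈ D

  circuitThrough-⊆ : ∀ {X Y e} → X ⊆ Y → CircuitThrough X e → CircuitThrough Y e
  circuitThrough-⊆ X⊆Y (D , circuit , D⊆X , e∈D) = D , circuit , X⊆Y ∘ D⊆X , e∈D

  loop-circuitThrough : ∀ {X l} → l ∈ X → l ∈ L → CircuitThrough X l
  loop-circuitThrough {l = l} l∈X l∈L = ⁅ l ⁆ , loop-circuit l∈L , ⁅x⁆⊆p l∈X , x∈⁅x⁆ l

  parallel-circuitThrough : ∀ {X e f} → NonLoop X e → NonLoop X f → e ≢ f → e ∥ f → CircuitThrough X e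
  parallel-circuitThrough {e = e} {f} (e∈X , e∉L) (f∈X , f∉L) e≢f e∥f =
    ⁅ e ⁆ ∪ ⁅ f ⁆ , parallel-circuit e∉L f∉L e≢f e∥f , ⁅x⁆∪⁅y⁆⊆p e∈X f∈X , x∈p∪q⁺ (inj₁ (x∈⁅x⁆ e))

  cyclic-partner : ∀ {X e} → IsCyclic matroid X → NonLoop X e → ∃ λ f → NonLoop X f × e ≢ f
  cyclic-partner {e = e} cyclic (e∈X , e∉L) with cyclic e e∈X
  ... | D , circuit , D⊆X , e∈D with circuit-partner circuit (e∈D , e∉L)
  ...   | f , (f∈D , f∉L) , e≢f = f , (D⊆X f∈D , f∉L) , e≢f

  flat⇒L⊆ : ∀ {X} → IsFlat matroid X → L ⊆ X
  flat⇒L⊆ {X} flat {l} l∈L = flat-closed matroid flat (rank₂-mono addLoop)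
    where
    addLoop : (X ∪ ⁅ l ⁆) ⊑ X
    addLoop ne with nonLoop-∪⁻ ne
    ... | inj₁ neX             = neX
    ... | inj₂ (e∈⁅l⁆ , e∉L) = contradiction (⁅x⁆⊆p l∈L e∈⁅l⁆) e∉L

  flat-pair⇒≡⊤ : ∀ {X} → IsFlat matroid X → HasNonParallelPair X → X ≡ ⊤
  flat-pair⇒≡⊤ flat pair =
    ⊆-antisym ⊆⊤ λ _ →
      flat-closed matroid flat (≤-trans (rank₂≤2 _) (≤-reflexive (sym (pair⇒rank₂≡2 pair))))

  flat-¬nonLoop⇒≡L : ∀ {X} → IsFlat matroid X → ¬ HasNonLoop X → X ≡ L
  flat-¬nonLoop⇒≡L {X} flat ¬any = ⊆-antisym X⊆L (flat⇒L⊆ flat)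
    where
    X⊆L : X ⊆ L
    X⊆L {e} e∈X with e ∈? L
    ... | yes e∈L = e∈L
    ... | no e∉L  = contradiction (e , e∈X , e∉L) ¬any

  flat-parallel : ∀ {X c y} → IsFlat matroid X → ¬ HasNonParallelPair X → NonLoop X c → c ∥ y → y ∈ X
  flat-parallel {X} {c} {y} flat ¬pair nc c∥y =
    flat-closed matroid flat (≤-trans (¬pair⇒rank₂≤1 (parallelTo⇒¬pair c∥)) (nonLoop⇒1≤rank₂ (c , nc)))
    where
    c∥ : ∀ {z} → NonLoop (X ∪ ⁅ y ⁆) z → c ∥ z
    c∥ nz with nonLoop-∪⁻ nz
    ... | inj₁ nzX           = pairwiseParallel ¬pair nc nzX
    ... | inj₂ (z∈⁅y⁆ , _) = subst (c ∥_) (sym (x∈⁅y⁆⇒x≡y y z∈⁅y⁆)) c∥y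

  parallelClass-flat : ∀ {X c} → L ⊆ X → NonLoop X c → (∀ {y} → c ∥ y → y ∈ X) →
                       (∀ {y} → NonLoop X y → c ∥ y) → IsFlat matroid X
  parallelClass-flat {X} {c} L⊆X nc closed c∥ y y∉X =
    ≤-trans (s≤s (¬pair⇒rank₂≤1 (parallelTo⇒¬pair c∥))) (≤-reflexive (sym (pair⇒rank₂≡2 pair)))
    where
    pair : HasNonParallelPair (X ∪ ⁅ y ⁆)
    pair = c , y , ⊆⇒⊑ (p⊆p∪q ⁅ y ⁆) nc , (x∈p∪q⁺ (inj₂ (x∈⁅x⁆ y)) , y∉X ∘ L⊆X) , y∉X ∘ closed

  loops-cyclicFlat : IsCyclicFlat matroid L
  loops-cyclicFlat = flat , λ l l∈L → loop-circuitThrough l∈L l∈L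
    where
    flat : IsFlat matroid L
    flat e e∉L = ≤-trans (s≤s (≤-reflexive (¬nonLoop⇒rank₂≡0 λ { (_ , e∈L , e∉L) → e∉L e∈L })))
                         (nonLoop⇒1≤rank₂ (e , x∈p∪q⁺ (inj₂ (x∈⁅x⁆ e)) , e∉L))

module Blocks {n s : ℕ} (L : Subset n) (P : Fin s → Subset n)
              (blocks-disjoint : ∀ i j → i ≢ j → Disjoint (P i) (P j)) where

  _∥_ : Rel (Fin n) 0ℓ
  e ∥ f = e ≡ f ⊎ ∃ λ i → e ∈ P i × f ∈ P i

  block-unique : ∀ {i j x} → x ∈ P i → x ∈ P j → i ≡ j
  block-unique {i} {j} x∈i x∈j with i ≟ j
  ... | yes i≡j = i≡j
  ... | no i≢j  = contradiction (subst (_ ∈_) (blocks-disjoint i j i≢j) (x∈p∩q⁺ (x∈i , x∈j))) ∉⊥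

  ∥-block : ∀ {i c y} → c ∈ P i → c ∥ y → y ∈ P i
  ∥-block c∈i (inj₁ refl) = c∈i
  ∥-block c∈i (inj₂ (j , c∈j , y∈j)) = subst (λ k → _ ∈ P k) (block-unique c∈j c∈i) y∈j

  ∥-sym : ∀ {e f} → e ∥ f → f ∥ e
  ∥-sym (inj₁ refl) = inj₁ refl
  ∥-sym (inj₂ (i , e∈i , f∈i)) = inj₂ (i , f∈i , e∈i)

  ∥-trans : ∀ {e f g} → e ∥ f → f ∥ g → e ∥ g
  ∥-trans (inj₁ refl) f∥g = f∥g
  ∥-trans (inj₂ (i , e∈i , f∈i)) f∥g = inj₂ (i , e∈i , ∥-block f∈i f∥g)

  ∥-isDecEquivalence : IsDecEquivalence _∥_
  ∥-isDecEquivalence = record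
    { isEquivalence = record { refl = inj₁ refl ; sym = ∥-sym ; trans = ∥-trans }
    ; _≟_           = λ e f → (e ≟ f) ⊎-dec any? (λ i → (e ∈? P i) ×-dec (f ∈? P i))
    }

  distinct-blocks-∦ : ∀ {i j x y} → i ≢ j → x ∈ P i → y ∈ P j → ¬ x ∥ y
  distinct-blocks-∦ i≢j x∈i y∈j x∥y = i≢j (block-unique (∥-block x∈i x∥y) y∈j)

  open RankTwo L ∥-isDecEquivalence public

  module CyclicFlats (blocks-avoid-L : ∀ i {x} → x ∈ P i → x ∉ L) (block-size : ∀ i → 2 ≤ ∣ P i ∣)
                     (i₀ i₁ : Fin s) (i₀≢i₁ : i₀ ≢ i₁) where

    element : ∀ i → Nonempty (P i)
    element i = 1≤∣p∣⇒Nonempty (≤-trans (s≤s z≤n) (block-size i))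

    block-nonLoop : ∀ {i x} → x ∈ P i → NonLoop (L ∪ P i) x
    block-nonLoop {i} x∈i = x∈p∪q⁺ (inj₂ x∈i) , blocks-avoid-L i x∈i

    block-parallel : ∀ {i c y} → c ∈ P i → NonLoop (L ∪ P i) y → c ∥ y
    block-parallel {i} c∈i (y∈ , y∉L) =
      inj₂ (i , c∈i , [ (λ y∈L → contradiction y∈L y∉L) , id ]′ (x∈p∪q⁻ L (P i) y∈))

    block-cyclicFlat : ∀ i → IsCyclicFlat matroid (L ∪ P i)
    block-cyclicFlat i =
      parallelClass-flat (p⊆p∪q (P i)) (block-nonLoop c∈i) (q⊆p∪q L (P i) ∘ ∥-block c∈i)
                         (block-parallel c∈i) ,
      cyclic
      where
      c∈i = proj₂ (element i)
      cyclic : IsCyclic matroid (L ∪ P i)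
      cyclic e e∈ with x∈p∪q⁻ L (P i) e∈
      ... | inj₁ e∈L = loop-circuitThrough e∈ e∈L
      ... | inj₂ e∈i with other-element {x = e} (block-size i)
      ...   | f , f∈i , e≢f =
        parallel-circuitThrough (block-nonLoop e∈i) (block-nonLoop f∈i) e≢f (inj₂ (i , e∈i , f∈i))

    full-cyclicFlat : IsCyclicFlat matroid ⊤
    full-cyclicFlat = (λ e e∉⊤ → contradiction ∈⊤ e∉⊤) , cyclic
      where
      c₀ = proj₁ (element i₀)
      c₀∈ = proj₂ (element i₀)
      c₁ = proj₁ (element i₁)
      c₁∈ = proj₂ (element i₁)
      cyclic : IsCyclic matroid ⊤
      cyclic e _ with e ∈? L | any? (λ i → e ∈? P i)
      ... | yes e∈L | _ = loop-circuitThrough ∈⊤ e∈L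
      ... | no _ | yes (i , e∈i) = circuitThrough-⊆ ⊆⊤ (proj₂ (block-cyclicFlat i) e (x∈p∪q⁺ (inj₂ e∈i)))
      ... | no e∉L | no e∉blocks =
        ⁅ e ⁆ ∪ ⁅ c₀ ⁆ ∪ ⁅ c₁ ⁆ ,
        triangle-circuit e∉L (blocks-avoid-L i₀ c₀∈) (blocks-avoid-L i₁ c₁∈)
          (λ e∥c₀ → e∉blocks (i₀ , ∥-block c₀∈ (∥-sym e∥c₀)))
          (λ e∥c₁ → e∉blocks (i₁ , ∥-block c₁∈ (∥-sym e∥c₁)))
          (distinct-blocks-∦ i₀≢i₁ c₀∈ c₁∈) ,
        (λ _ → ∈⊤) , x∈p∪q⁺ (inj₁ (x∈⁅x⁆ e))

    rank-one-cyclicFlat≡block : ∀ {X e} → IsCyclicFlat matroid X → ¬ HasNonParallelPair X →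
                                NonLoop X e → ∃ λ i → X ≡ L ∪ P i
    rank-one-cyclicFlat≡block {X} (flat , cyclic) ¬pair ne with cyclic-partner cyclic ne
    ... | f , nf , e≢f with pairwiseParallel ¬pair ne nf
    ...   | inj₁ e≡f           = contradiction e≡f e≢f
    ...   | inj₂ (i , e∈i , _) = i , ⊆-antisym X⊆ ⊆X
      where
      X⊆ : X ⊆ L ∪ P i
      X⊆ {x} x∈X with x ∈? L
      ... | yes x∈L = x∈p∪q⁺ (inj₁ x∈L)
      ... | no x∉L  = x∈p∪q⁺ (inj₂ (∥-block e∈i (pairwiseParallel ¬pair ne (x∈X , x∉L))))
      ⊆X : L ∪ P i ⊆ X
      ⊆X y∈ = [ flat⇒L⊆ flat , (λ y∈i → flat-parallel flat ¬pair ne (inj₂ (i , e∈i , y∈i))) ]′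
                (x∈p∪q⁻ L (P i) y∈)

    cyclicFlat⇒In𝓛 : ∀ {X} → IsCyclicFlat matroid X → In𝓛 L P X
    cyclicFlat⇒In𝓛 {X} cyclicFlat = cases (hasNonParallelPair? X) (hasNonLoop? X)
      where
      cases : Dec (HasNonParallelPair X) → Dec (HasNonLoop X) → In𝓛 L P X
      cases (yes pair) _              = inj₂ (inj₂ (flat-pair⇒≡⊤ (proj₁ cyclicFlat) pair))
      cases (no ¬pair) (yes (_ , ne)) = inj₂ (inj₁ (rank-one-cyclicFlat≡block cyclicFlat ¬pair ne))
      cases (no _)     (no ¬any)      = inj₁ (flat-¬nonLoop⇒≡L (proj₁ cyclicFlat) ¬any)

    In𝓛⇒cyclicFlat : ∀ {X} → In𝓛 L P X → IsCyclicFlat matroid X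
    In𝓛⇒cyclicFlat (inj₁ refl) = loops-cyclicFlat
    In𝓛⇒cyclicFlat (inj₂ (inj₁ (i , refl))) = block-cyclicFlat i
    In𝓛⇒cyclicFlat (inj₂ (inj₂ refl)) = full-cyclicFlat

    loops-rank : rank₂ L ≡ 0
    loops-rank = ¬nonLoop⇒rank₂≡0 λ { (_ , e∈L , e∉L) → e∉L e∈L }

    block-rank : ∀ i → rank₂ (L ∪ P i) ≡ 1
    block-rank i with element i
    ... | c , c∈i = ≤-antisym (¬pair⇒rank₂≤1 (parallelTo⇒¬pair (block-parallel c∈i)))
                              (nonLoop⇒1≤rank₂ (c , block-nonLoop c∈i))

    full-rank : rank₂ ⊤ ≡ 2
    full-rank with element i₀ | element i₁
    ... | c₀ , c₀∈ | c₁ , c₁∈ =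
      pair⇒rank₂≡2 (c₀ , c₁ , (∈⊤ , blocks-avoid-L i₀ c₀∈) , (∈⊤ , blocks-avoid-L i₁ c₁∈) ,
                    distinct-blocks-∦ i₀≢i₁ c₀∈ c₁∈)

    block-⊈ : ∀ {i j} → i ≢ j → ¬ (L ∪ P i ⊆ L ∪ P j)
    block-⊈ {i} {j} i≢j ⊆ with element i
    ... | c , c∈i =
      [ blocks-avoid-L i c∈i , (λ c∈j → i≢j (block-unique c∈i c∈j)) ]′
        (x∈p∪q⁻ L (P j) (⊆ (x∈p∪q⁺ (inj₂ c∈i))))

    not-Schubert : ¬ IsSchubert matroid
    not-Schubert schubert with schubert _ _ (block-cyclicFlat i₀) (block-cyclicFlat i₁)
    ... | inj₁ ⊆ = block-⊈ i₀≢i₁ ⊆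
    ... | inj₂ ⊆ = block-⊈ (i₀≢i₁ ∘ sym) ⊆

lemma3p2 : (n : ℕ) → 4 ≤ n → (L C : Subset n) → Disjoint L C → 4 ≤ ∣ C ∣ →
    (s : ℕ) → 2 ≤ s → (P : Fin s → Subset n) → IsPartition C P →
    Σ (Matroid n) λ M →
      rk M ≡ 2 ×
      (∀ X → IsCyclicFlat M X ⇔ In𝓛 L P X) ×
      rank M L ≡ 0 ×
      (∀ i → rank M (L ∪ P i) ≡ 1) ×
      rank M ⊤ ≡ 2 ×
      ¬ IsSchubert M
lemma3p2 n _ L C L∩C≡⊥ _ _ (s≤s (s≤s z≤n)) P (blocks-disjoint , _ , P⊆C , block-size) =
  matroid , full-rank , (λ _ → mk⇔ cyclicFlat⇒In𝓛 In𝓛⇒cyclicFlat) ,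
  loops-rank , block-rank , full-rank , not-Schubert
  where
  open Blocks L P blocks-disjoint
  blocks-avoid-L : ∀ i {x} → x ∈ P i → x ∉ L
  blocks-avoid-L i x∈i x∈L = ∉⊥ (subst (_ ∈_) L∩C≡⊥ (x∈p∩q⁺ (x∈L , P⊆C i x∈i)))
  open CyclicFlats blocks-avoid-L block-size zero (suc zero) (λ ())
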